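{- Let $G$ be an $S$-graph with a spanning $S$-forest $F$. Then for every $L(F)$-$B(G,F)$ alternating even cycle $C$ of $G$, the number of $2$-$2$ edges lying on $C$ equals the number of $3$-$3$ edges lying on $C$.
   Context: Graphs are finite, simple. The spanner is the tree on 10 vertices obtained from two paths $a_1b_1c_1d_1e_1$ and $a_2b_2c_2d_2e_2$ by adding the edge $c_1c_2$; a vertex of degree $i$ in it is an $i$-vertex; the base of a vertex is the nearest $3$-vertex. $U(S)$: edges of spanner $S$ incident to a $1$-vertex; $L(S)$: edges not in $U(S)$ incident to a $2$-vertex. An $S$-forest is a forest whose components are spanners, with $i$-vertices, bases, $U(F)$, $L(F)$ inherited (unions). An $S$-graph is a graph containing an $S$-forest $F$ as a spanning subgraph. An $i$-$j$ edge is an edge of $G$ joining an $i$-vertex and a $j$-vertex of $F$. $\Delta(G,F)$ is the set of edges of $G$ joining a $1$-vertex of $F$ to its base; $B(G,F)=E(G)\setminus(L(F)\cup U(F)\cup\Delta(G,F))$. A trail is a sequence $v_0,e_1,v_1,\dots,e_n,v_n$ with $e_j=(v_{j-1},v_j)$ and pairwise distinct edges (vertices may repeat); it is a cycle if $v_0=v_n$, even if $n$ is even. An $L(F)$-$B(G,F)$ alternating trail has edges alternately in $L(F)$ and $B(G,F)$. -}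

module Defs where

open import Data.Nat using (ℕ; zero; suc; _≡ᵇ_)
open import Data.Nat.Divisibility using (_∣_)
open import Data.Fin using (Fin; toℕ; inject₁; fromℕ) renaming (zero to fz; suc to fs)
open import Data.Bool using (Bool; T; _∧_; _∨_; not)
open import Data.Product using (_×_; _,_; proj₁; proj₂)
open import Data.Sum using (_⊎_)
open import Data.List using (List; length; filterᵇ; allFin)
open import Relation.Nullary using (¬_)
open import Relation.Binary.PropositionalEquality using (_≡_; _≢_)

-- Vertex (s , p) : side s ∈ {0,1} (path 1 or path 2), position
-- p ∈ {0,…,4} standing for a,b,c,d,e.  Edges: consecutive vertices of
-- the same path  a_s b_s c_s d_s e_s, plus the edge c_1 c_2.

SV : Set
SV = Fin 2 × Fin 5

sadj : SV → SV → Bool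
sadj (s , p) (s' , p') =
  ((toℕ s ≡ᵇ toℕ s') ∧ ((suc (toℕ p) ≡ᵇ toℕ p') ∨ (suc (toℕ p') ≡ᵇ toℕ p)))
  ∨ ((toℕ p ≡ᵇ 2) ∧ ((toℕ p' ≡ᵇ 2) ∧ not (toℕ s ≡ᵇ toℕ s')))

-- Base of a vertex of the spanner (nearest 3-vertex): the 3-vertices
-- are c_1 , c_2 and the nearest one to any vertex of path s is c_s.
sbase : SV → SV
sbase (s , p) = (s , fs (fs fz))

record Graph (n : ℕ) : Set₁ where
  field
    Adj    : Fin n → Fin n → Set
    sym    : ∀ {u v} → Adj u v → Adj v u
    irrefl : ∀ {u} → ¬ Adj u u

-- An S-forest on vertex set Fin n: a forest whose components are
-- spanners, given as an explicit isomorphism of its vertex set with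
-- (Fin k) × SV (k copies of the spanner); edges are the spanner edges
-- inside each copy.

record SForest (n : ℕ) : Set where
  field
    k     : ℕ
    lab   : Fin n → Fin k × SV
    unlab : Fin k × SV → Fin n
    inv₁  : ∀ v → unlab (lab v) ≡ v
    inv₂  : ∀ x → lab (unlab x) ≡ x

module _ {n : ℕ} (F : SForest n) where
  open SForest F

  comp : Fin n → Fin k
  comp v = proj₁ (lab v)

  loc : Fin n → SV
  loc v = proj₂ (lab v)

  fadjᵇ : Fin n → Fin n → Bool
  fadjᵇ u v = (toℕ (comp u) ≡ᵇ toℕ (comp v)) ∧ sadj (loc u) (loc v)

  FAdj : Fin n → Fin n → Set
  FAdj u v = T (fadjᵇ u v)

  deg : Fin n → ℕ
  deg v = length (filterᵇ (fadjᵇ v) (allFin n))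

  base : Fin n → Fin n
  base v = unlab (comp v , sbase (loc v))

  InU : Fin n → Fin n → Set
  InU u v = FAdj u v × (deg u ≡ 1 ⊎ deg v ≡ 1)

  InL : Fin n → Fin n → Set
  InL u v = FAdj u v × (¬ (deg u ≡ 1 ⊎ deg v ≡ 1)) × (deg u ≡ 2 ⊎ deg v ≡ 2)

  is22 : Fin n → Fin n → Bool
  is22 u v = (deg u ≡ᵇ 2) ∧ (deg v ≡ᵇ 2)

  is33 : Fin n → Fin n → Bool
  is33 u v = (deg u ≡ᵇ 3) ∧ (deg v ≡ᵇ 3)

-- F is a spanning subgraph of G (so G is an S-graph with S-forest F)
Spanning : {n : ℕ} → Graph n → SForest n → Set
Spanning G F = ∀ u v → FAdj F u v → Graph.Adj G u v

module _ {n : ℕ} (G : Graph n) (F : SForest n) where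
  open Graph G

  InΔ : Fin n → Fin n → Set
  InΔ u v = Adj u v ×
    ((deg F u ≡ 1 × base F u ≡ v) ⊎ (deg F v ≡ 1 × base F v ≡ u))

  InB : Fin n → Fin n → Set
  InB u v = Adj u v × (¬ InL F u v) × (¬ InU F u v) × (¬ InΔ u v)

-- Closed trails (cycles in the trail sense) of G.
-- Vertices w 0 , … , w m with w 0 ≡ w m; the j-th edge (j : Fin m)
-- joins w j and w (j+1); edges (unordered pairs) pairwise distinct.

SameEdge : {n : ℕ} → Fin n → Fin n → Fin n → Fin n → Set
SameEdge a b c d = (a ≡ c × b ≡ d) ⊎ (a ≡ d × b ≡ c)

record ClosedTrail {n : ℕ} (G : Graph n) : Set where
  field
    len      : ℕ
    w        : Fin (suc len) → Fin n
    adj      : ∀ (j : Fin len) → Graph.Adj G (w (inject₁ j)) (w (fs j))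
    closed   : w fz ≡ w (fromℕ len)
    distinct : ∀ (i j : Fin len) → i ≢ j →
               ¬ SameEdge (w (inject₁ i)) (w (fs i)) (w (inject₁ j)) (w (fs j))

  src : Fin len → Fin n
  src j = w (inject₁ j)

  tgt : Fin len → Fin n
  tgt j = w (fs j)

open ClosedTrail public

IsEven : {n : ℕ} {G : Graph n} → ClosedTrail G → Set
IsEven C = 2 ∣ len C

Alternating : {n : ℕ} (G : Graph n) (F : SForest n) → ClosedTrail G → Set
Alternating G F C = ∀ (i j : Fin (len C)) → toℕ j ≡ suc (toℕ i) →
    (InL F (src C i) (tgt C i) × InB G F (src C j) (tgt C j))
  ⊎ (InB G F (src C i) (tgt C i) × InL F (src C j) (tgt C j))

count22 : {n : ℕ} {G : Graph n} → SForest n → ClosedTrail G → ℕ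
count22 F C = length (filterᵇ (λ j → is22 F (src C j) (tgt C j)) (allFin (len C)))

count33 : {n : ℕ} {G : Graph n} → SForest n → ClosedTrail G → ℕ
count33 F C = length (filterᵇ (λ j → is33 F (src C j) (tgt C j)) (allFin (len C)))

module Submission where

-- A spanner edge avoiding the 1-vertices and touching a 2-vertex
-- is one of b_s c_s, c_s d_s, so every L(F)-edge joins a 2-vertex and a
-- 3-vertex of F.  Split C (of length 2q) into q consecutive pairs of
-- edges; by alternation either every pair is (L-edge, B-edge) or every
-- pair is (B-edge, L-edge).  Writing t(x) = [x = 3], a case check on the
-- degrees (x₀ , x₁ , x₂) of the three vertices of a pair shows that
-- (#33 - #22)(pair) = t(x₂) - t(x₀) in the first case and the negative
-- in the second; the sum telescopes around the closed trail to 0.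

open import Defs
open import Data.Nat using (ℕ; zero; suc; _+_; _*_; _<_; _≡ᵇ_; s≤s; z≤n; z<s)
open import Data.Nat.Properties as ℕ
  using (+-assoc; +-cancelʳ-≡; +-commutativeSemigroup; ≡ᵇ⇒≡; ≡⇒≡ᵇ; *-monoˡ-≤;
         <-trans; n<1+n; m+n≤o⇒n≤o; m≤n⇒m<n∨m≡n)
open import Algebra.Properties.CommutativeSemigroup +-commutativeSemigroup
  using (interchange; xy∙z≈xz∙y; xy∙z≈x∙zy)
open import Data.Nat.Divisibility using (divides)
open import Data.Fin using (Fin; toℕ; inject₁; fromℕ; fromℕ<) renaming (zero to fz; suc to fs)
open import Data.Fin.Properties using (all?; suc-injective; toℕ-injective; toℕ-inject₁; toℕ-fromℕ; toℕ-fromℕ<)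
  renaming (_≟_ to _≟ᶠ_)
open import Data.Bool using (Bool; true; false; T; _∧_; _∨_; not)
open import Data.Bool.Properties using (T?; T-∧; T-not-≡; ∧-zeroʳ; ∧-distribˡ-∨) renaming (_≟_ to _≟ᵇ_)
open import Data.Bool.ListAction using (any)
open import Data.Unit using (tt)
open import Data.Empty using (⊥-elim)
open import Data.Product as Product using (_×_; _,_; proj₁; proj₂)
open import Data.Product.Properties using (≡-dec)
open import Data.Sum as Sum using (_⊎_; inj₁; inj₂)
open import Data.List using (List; []; _∷_; length; filterᵇ; allFin; tabulate)
open import Function using (_∘_; id; Equivalence)
open import Relation.Nullary using (¬_; Dec)
open import Relation.Nullary.Decidable
  using (⌊_⌋; from-yes; map′; toWitness; fromWitness; _×-dec_; _⊎-dec_; _→-dec_; ¬?)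
open import Relation.Binary.PropositionalEquality
  using (_≡_; _≢_; refl; sym; trans; cong; cong₂; subst; module ≡-Reasoning)
open ≡-Reasoning

[_] : Bool → ℕ
[ true ] = 1
[ false ] = 0

[_]≡1 : ∀ {b} → T b → [ b ] ≡ 1
[_]≡1 {true} _ = refl

[_]≡0 : ∀ {b} → ¬ T b → [ b ] ≡ 0
[_]≡0 {true} ¬b = ⊥-elim (¬b tt)
[_]≡0 {false} _ = refl

[∨]-disjoint : ∀ a b → ¬ (T a × T b) → [ a ∨ b ] ≡ [ a ] + [ b ]
[∨]-disjoint true true ¬ab = ⊥-elim (¬ab (tt , tt))
[∨]-disjoint true false _ = refl
[∨]-disjoint false b _ = refl

count : ∀ m → (Fin m → Bool) → ℕ
count zero p = 0
count (suc m) p = [ p fz ] + count m (p ∘ fs)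

sumBelow : ℕ → (ℕ → ℕ) → ℕ
sumBelow zero g = 0
sumBelow (suc q) g = g 0 + sumBelow q (g ∘ suc)

length-filter-tabulate : ∀ {A : Set} m (f : Fin m → A) (p : A → Bool) →
                         length (filterᵇ p (tabulate f)) ≡ count m (p ∘ f)
length-filter-tabulate zero f p = refl
length-filter-tabulate (suc m) f p with p (f fz)
... | true = cong suc (length-filter-tabulate m (f ∘ fs) p)
... | false = length-filter-tabulate m (f ∘ fs) p

length-filter-allFin : ∀ m (p : Fin m → Bool) → length (filterᵇ p (allFin m)) ≡ count m p
length-filter-allFin m p = length-filter-tabulate m id p

count-cong : ∀ m {p r : Fin m → Bool} → (∀ j → p j ≡ r j) → count m p ≡ count m r
count-cong zero eq = refl
count-cong (suc m) eq = cong₂ _+_ (cong [_] (eq fz)) (count-cong m (eq ∘ fs))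

count-toℕ : ∀ m (g : ℕ → Bool) → count m (g ∘ toℕ) ≡ sumBelow m ([_] ∘ g)
count-toℕ zero g = refl
count-toℕ (suc m) g = cong ([ g 0 ] +_) (count-toℕ m (g ∘ suc))

count-none : ∀ m (p : Fin m → Bool) → (∀ j → ¬ T (p j)) → count m p ≡ 0
count-none zero p none = refl
count-none (suc m) p none = cong₂ _+_ [ none fz ]≡0 (count-none m (p ∘ fs) (none ∘ fs))

count-point : ∀ m (p : Fin m → Bool) (x : Fin m) →
              (∀ j → T (p j) → j ≡ x) → T (p x) → count m p ≡ 1
count-point (suc m) p fz only px =
  cong₂ _+_ [ px ]≡1 (count-none m (p ∘ fs) λ j pj → fs≢fz (only (fs j) pj))
  where
  fs≢fz : ∀ {j : Fin m} → fs j ≢ fz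
  fs≢fz ()
count-point (suc m) p (fs x) only px =
  cong₂ _+_ [ (λ p0 → fz≢fs (only fz p0)) ]≡0
            (count-point m (p ∘ fs) x (λ j pj → suc-injective (only (fs j) pj)) px)
  where
  fz≢fs : fz ≢ fs x
  fz≢fs ()

count-∨ : ∀ m (p r : Fin m → Bool) → (∀ j → ¬ (T (p j) × T (r j))) →
          count m (λ j → p j ∨ r j) ≡ count m p + count m r
count-∨ zero p r disjoint = refl
count-∨ (suc m) p r disjoint = begin
  [ p fz ∨ r fz ] + count m (λ j → p (fs j) ∨ r (fs j))
    ≡⟨ cong₂ _+_ ([∨]-disjoint (p fz) (r fz) (disjoint fz)) (count-∨ m _ _ (disjoint ∘ fs)) ⟩
  ([ p fz ] + [ r fz ]) + (count m (p ∘ fs) + count m (r ∘ fs))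
    ≡⟨ interchange [ p fz ] [ r fz ] _ _ ⟩
  count (suc m) p + count (suc m) r ∎

pairSum : (ℕ → ℕ) → ℕ → ℕ
pairSum g k = g (k * 2) + g (suc (k * 2))

sum-pairs : ∀ q g → sumBelow (q * 2) g ≡ sumBelow q (pairSum g)
sum-pairs zero g = refl
sum-pairs (suc q) g = begin
  g 0 + (g 1 + sumBelow (q * 2) (g ∘ suc ∘ suc)) ≡⟨ sym (+-assoc (g 0) (g 1) _) ⟩
  g 0 + g 1 + sumBelow (q * 2) (g ∘ suc ∘ suc)   ≡⟨ cong (g 0 + g 1 +_) (sum-pairs q (g ∘ suc ∘ suc)) ⟩
  sumBelow (suc q) (pairSum g)                    ∎

telescope : ∀ q (a b f : ℕ → ℕ) → (∀ k → k < q → a k + f k ≡ b k + f (suc k)) →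
            sumBelow q a + f 0 ≡ sumBelow q b + f q
telescope zero a b f step = refl
telescope (suc q) a b f step = begin
  a 0 + A + f 0     ≡⟨ xy∙z≈xz∙y (a 0) A (f 0) ⟩
  a 0 + f 0 + A     ≡⟨ cong (_+ A) (step 0 z<s) ⟩
  b 0 + f 1 + A     ≡⟨ xy∙z≈x∙zy (b 0) (f 1) A ⟩
  b 0 + (A + f 1)   ≡⟨ cong (b 0 +_) (telescope q (a ∘ suc) (b ∘ suc) (f ∘ suc) (λ k → step (suc k) ∘ s≤s)) ⟩
  b 0 + (B + f (suc q)) ≡⟨ sym (+-assoc (b 0) B _) ⟩
  b 0 + B + f (suc q) ∎
  where
  A B : ℕ
  A = sumBelow q (a ∘ suc)
  B = sumBelow q (b ∘ suc)

telescope-closed : ∀ q (a b f : ℕ → ℕ) → (∀ k → k < q → a k + f k ≡ b k + f (suc k)) →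
                   f 0 ≡ f q → sumBelow q a ≡ sumBelow q b
telescope-closed q a b f step closed =
  +-cancelʳ-≡ (f 0) _ _ (trans (telescope q a b f step) (cong (sumBelow q b +_) (sym closed)))

_≟SV_ : (x y : SV) → Dec (x ≡ y)
_≟SV_ = ≡-dec _≟ᶠ_ _≟ᶠ_

≟SV-sound : ∀ {x y} → T (⌊ x ≟SV y ⌋) → x ≡ y
≟SV-sound {x} {y} = toWitness {a? = x ≟SV y}

≟SV-complete : ∀ {x y} → x ≡ y → T (⌊ x ≟SV y ⌋)
≟SV-complete {x} {y} = fromWitness {a? = x ≟SV y}

_∈ᵇ_ : SV → List SV → Bool
x ∈ᵇ ys = any (λ y → ⌊ x ≟SV y ⌋) ys

duplicateFree : List SV → Bool
duplicateFree [] = true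
duplicateFree (x ∷ xs) = not (x ∈ᵇ xs) ∧ duplicateFree xs

all-SV? : {P : SV → Set} → (∀ x → Dec (P x)) → Dec (∀ x → P x)
all-SV? P? = map′ (λ h (s , p) → h s p) (λ h s p → h (s , p))
                  (all? λ s → all? λ p → P? (s , p))

other : Fin 2 → Fin 2
other fz = fs fz
other (fs _) = fz

a b c d e : Fin 5
a = fz
b = fs fz
c = fs (fs fz)
d = fs (fs (fs fz))
e = fs (fs (fs (fs fz)))

neighbours : SV → List SV
neighbours (s , fz) = (s , b) ∷ []
neighbours (s , fs fz) = (s , a) ∷ (s , c) ∷ []
neighbours (s , fs (fs fz)) = (s , b) ∷ (s , d) ∷ (other s , c) ∷ []
neighbours (s , fs (fs (fs fz))) = (s , c) ∷ (s , e) ∷ []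
neighbours (s , fs (fs (fs (fs fz)))) = (s , d) ∷ []

sdeg : SV → ℕ
sdeg x = length (neighbours x)

sadj-neighbours : ∀ x y → sadj x y ≡ y ∈ᵇ neighbours x
sadj-neighbours = from-yes (all-SV? λ x → all-SV? λ y → sadj x y ≟ᵇ (y ∈ᵇ neighbours x))

neighbours-duplicateFree : ∀ x → T (duplicateFree (neighbours x))
neighbours-duplicateFree = from-yes (all-SV? λ x → T? (duplicateFree (neighbours x)))

Is23 : ℕ → ℕ → Set
Is23 x y = (x ≡ 2 × y ≡ 3) ⊎ (x ≡ 3 × y ≡ 2)

Two3 : ℕ → Set
Two3 x = x ≡ 2 ⊎ x ≡ 3

Is23⇒Two3ˡ : ∀ {x y} → Is23 x y → Two3 x
Is23⇒Two3ˡ (inj₁ (x≡2 , _)) = inj₁ x≡2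
Is23⇒Two3ˡ (inj₂ (x≡3 , _)) = inj₂ x≡3

Is23⇒Two3ʳ : ∀ {x y} → Is23 x y → Two3 y
Is23⇒Two3ʳ (inj₁ (_ , y≡3)) = inj₂ y≡3
Is23⇒Two3ʳ (inj₂ (_ , y≡2)) = inj₁ y≡2

spanner-L-edge : ∀ x y → T (sadj x y) → ¬ (sdeg x ≡ 1 ⊎ sdeg y ≡ 1) →
                 (sdeg x ≡ 2 ⊎ sdeg y ≡ 2) → Is23 (sdeg x) (sdeg y)
spanner-L-edge = from-yes (all-SV? λ x → all-SV? λ y →
  T? (sadj x y) →-dec (¬? ((sdeg x ℕ.≟ 1) ⊎-dec (sdeg y ℕ.≟ 1)) →-dec
    (((sdeg x ℕ.≟ 2) ⊎-dec (sdeg y ℕ.≟ 2)) →-dec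
     (((sdeg x ℕ.≟ 2) ×-dec (sdeg y ℕ.≟ 3)) ⊎-dec ((sdeg x ℕ.≟ 3) ×-dec (sdeg y ℕ.≟ 2))))))

module _ {n : ℕ} (F : SForest n) where
  open SForest F

  sameComp : Fin k → Fin n → Bool
  sameComp i w = toℕ i ≡ᵇ toℕ (comp F w)

  isCopy : Fin k → SV → Fin n → Bool
  isCopy i x w = sameComp i w ∧ ⌊ loc F w ≟SV x ⌋

  isCopy-unique : ∀ i x w → T (isCopy i x w) → w ≡ unlab (i , x)
  isCopy-unique i x w h = begin
    w                         ≡⟨ sym (inv₁ w) ⟩
    unlab (comp F w , loc F w) ≡⟨ cong unlab (cong₂ _,_ (sym same) (≟SV-sound (proj₂ parts))) ⟩
    unlab (i , x)             ∎
    where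
    parts : T (sameComp i w) × T ⌊ loc F w ≟SV x ⌋
    parts = Equivalence.to T-∧ h
    same : i ≡ comp F w
    same = toℕ-injective (≡ᵇ⇒≡ _ _ (proj₁ parts))

  isCopy-unlab : ∀ i x → T (isCopy i x (unlab (i , x)))
  isCopy-unlab i x =
    Equivalence.from T-∧ (≡⇒≡ᵇ _ _ (cong toℕ (sym (cong proj₁ lab≡))) , ≟SV-complete (cong proj₂ lab≡))
    where
    lab≡ : lab (unlab (i , x)) ≡ (i , x)
    lab≡ = inv₂ (i , x)

  count-copies : ∀ i xs → T (duplicateFree xs) →
                 count n (λ w → sameComp i w ∧ (loc F w ∈ᵇ xs)) ≡ length xs
  count-copies i [] _ =
    trans (count-cong n (λ w → ∧-zeroʳ (sameComp i w))) (count-none n _ (λ _ ()))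
  count-copies i (x ∷ xs) dupFree = begin
    count n (λ w → sameComp i w ∧ (⌊ loc F w ≟SV x ⌋ ∨ (loc F w ∈ᵇ xs)))
      ≡⟨ count-cong n (λ w → ∧-distribˡ-∨ (sameComp i w) _ _) ⟩
    count n (λ w → isCopy i x w ∨ (sameComp i w ∧ (loc F w ∈ᵇ xs)))
      ≡⟨ count-∨ n _ _ disjoint ⟩
    count n (isCopy i x) + count n (λ w → sameComp i w ∧ (loc F w ∈ᵇ xs))
      ≡⟨ cong₂ _+_ (count-point n _ _ (isCopy-unique i x) (isCopy-unlab i x))
                   (count-copies i xs (proj₂ parts)) ⟩
    suc (length xs) ∎
    where
    parts : T (not (x ∈ᵇ xs)) × T (duplicateFree xs)
    parts = Equivalence.to T-∧ dupFree
    x∉xs : ¬ T (x ∈ᵇ xs)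
    x∉xs x∈xs = subst T (Equivalence.to T-not-≡ (proj₁ parts)) x∈xs
    disjoint : ∀ w → ¬ (T (isCopy i x w) × T (sameComp i w ∧ (loc F w ∈ᵇ xs)))
    disjoint w (copy , member) =
      x∉xs (subst (λ y → T (y ∈ᵇ xs)) (≟SV-sound (proj₂ (Equivalence.to T-∧ copy)))
                  (proj₂ (Equivalence.to T-∧ member)))

  deg-spanner : ∀ v → deg F v ≡ sdeg (loc F v)
  deg-spanner v = begin
    deg F v                  ≡⟨ length-filter-allFin n (fadjᵇ F v) ⟩
    count n (fadjᵇ F v)      ≡⟨ count-cong n (λ w → cong (sameComp (comp F v) w ∧_)
                                                          (sadj-neighbours (loc F v) (loc F w))) ⟩
    count n (λ w → sameComp (comp F v) w ∧ (loc F w ∈ᵇ neighbours (loc F v)))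
                             ≡⟨ count-copies (comp F v) (neighbours (loc F v)) (neighbours-duplicateFree (loc F v)) ⟩
    sdeg (loc F v)           ∎

  L-edge-23 : ∀ u v → InL F u v → Is23 (deg F u) (deg F v)
  L-edge-23 u v (uv∈F , no1 , some2) rewrite deg-spanner u | deg-spanner v =
    spanner-L-edge (loc F u) (loc F v) (proj₂ (Equivalence.to T-∧ uv∈F)) no1 some2

-- A closed walk of length m is
-- abstracted to its degree sequence D 0 , … , D m (with D 0 = D m) and
-- the predicate L on edge positions (edge i joins positions i and i+1)
-- saying which edges are L-edges.

e22 e33 : ℕ → ℕ → Bool
e22 x y = (x ≡ᵇ 2) ∧ (y ≡ᵇ 2)
e33 x y = (x ≡ᵇ 3) ∧ (y ≡ᵇ 3)

three : ℕ → ℕ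
three x = [ x ≡ᵇ 3 ]

onEdge : (ℕ → ℕ → Bool) → (ℕ → ℕ) → ℕ → ℕ
onEdge P D i = [ P (D i) (D (suc i)) ]

-- The local identities for a pair of edges x - y - z whose first
-- (resp. second) edge is a 2-3 edge, the third vertex having degree 2
-- or 3: (#33 - #22) changes by three z - three x (resp. its negative).
LB-pair : ∀ {x y z} → Is23 x y → Two3 z →
          [ e33 x y ] + [ e33 y z ] + three x ≡ [ e22 x y ] + [ e22 y z ] + three z
LB-pair (inj₁ (refl , refl)) (inj₁ refl) = refl
LB-pair (inj₁ (refl , refl)) (inj₂ refl) = refl
LB-pair (inj₂ (refl , refl)) (inj₁ refl) = refl
LB-pair (inj₂ (refl , refl)) (inj₂ refl) = refl

BL-pair : ∀ {x y z} → Two3 x → Is23 y z →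
          [ e22 x y ] + [ e22 y z ] + three x ≡ [ e33 x y ] + [ e33 y z ] + three z
BL-pair (inj₁ refl) (inj₁ (refl , refl)) = refl
BL-pair (inj₁ refl) (inj₂ (refl , refl)) = refl
BL-pair (inj₂ refl) (inj₁ (refl , refl)) = refl
BL-pair (inj₂ refl) (inj₂ (refl , refl)) = refl

pair-bound : ∀ {k q} → k < q → suc (k * 2) < q * 2
pair-bound (s≤s k≤q) = s≤s (s≤s (*-monoˡ-≤ 2 k≤q))

even-bound : ∀ {k q} → k < q → k * 2 < q * 2
even-bound k<q = m+n≤o⇒n≤o 1 (pair-bound k<q)

module AlternatingCycle (p : ℕ) (D : ℕ → ℕ) (L : ℕ → Set)
  (closed : D 0 ≡ D (suc p * 2))
  (alternates : ∀ i → suc i < suc p * 2 → (L i × ¬ L (suc i)) ⊎ (¬ L i × L (suc i)))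
  (L-is-23 : ∀ i → L i → Is23 (D i) (D (suc i))) where

  L-skip : ∀ i → suc (suc i) < suc p * 2 → L i → L (suc (suc i))
  L-skip i bound Li with alternates i (m+n≤o⇒n≤o 1 bound) | alternates (suc i) bound
  ... | inj₂ (¬Li , _) | _ = ⊥-elim (¬Li Li)
  ... | inj₁ (_ , ¬L1+i) | inj₁ (L1+i , _) = ⊥-elim (¬L1+i L1+i)
  ... | inj₁ _ | inj₂ (_ , L2+i) = L2+i

  L-even : L 0 → ∀ k → k < suc p → L (k * 2)
  L-even L0 zero _ = L0
  L-even L0 (suc k) k<q = L-skip (k * 2) (even-bound k<q) (L-even L0 k (<-trans (n<1+n k) k<q))

  L-odd : L 1 → ∀ k → k < suc p → L (suc (k * 2))
  L-odd L1 zero _ = L1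
  L-odd L1 (suc k) k<q = L-skip (suc (k * 2)) (pair-bound k<q) (L-odd L1 k (<-trans (n<1+n k) k<q))

  count22-pairs : sumBelow (suc p * 2) (onEdge e22 D) ≡ sumBelow (suc p) (pairSum (onEdge e22 D))
  count22-pairs = sum-pairs (suc p) (onEdge e22 D)

  count33-pairs : sumBelow (suc p * 2) (onEdge e33 D) ≡ sumBelow (suc p) (pairSum (onEdge e33 D))
  count33-pairs = sum-pairs (suc p) (onEdge e33 D)

  threeAtPair : ℕ → ℕ
  threeAtPair k = three (D (k * 2))

  potential-closed : threeAtPair 0 ≡ threeAtPair (suc p)
  potential-closed = cong three closed

  balanced-LB : L 0 → sumBelow (suc p * 2) (onEdge e22 D) ≡ sumBelow (suc p * 2) (onEdge e33 D)
  balanced-LB L0 = begin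
    sumBelow (suc p * 2) (onEdge e22 D)       ≡⟨ count22-pairs ⟩
    sumBelow (suc p) (pairSum (onEdge e22 D)) ≡⟨ sym (telescope-closed (suc p) _ _ threeAtPair step potential-closed) ⟩
    sumBelow (suc p) (pairSum (onEdge e33 D)) ≡⟨ sym count33-pairs ⟩
    sumBelow (suc p * 2) (onEdge e33 D)       ∎
    where
    -- the vertex closing pair k starts the next L-edge (or is D 0 = D m)
    closing-vertex : ∀ k → k < suc p → Two3 (D (suc k * 2))
    closing-vertex k k<q with m≤n⇒m<n∨m≡n k<q
    ... | inj₁ 1+k<q = Is23⇒Two3ˡ (L-is-23 _ (L-even L0 (suc k) 1+k<q))
    ... | inj₂ 1+k≡q = subst (λ j → Two3 (D (j * 2))) (sym 1+k≡q)
                             (subst Two3 closed (Is23⇒Two3ˡ (L-is-23 0 L0)))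
    step : ∀ k → k < suc p →
           pairSum (onEdge e33 D) k + threeAtPair k ≡ pairSum (onEdge e22 D) k + threeAtPair (suc k)
    step k k<q = LB-pair (L-is-23 (k * 2) (L-even L0 k k<q)) (closing-vertex k k<q)

  balanced-BL : L 1 → sumBelow (suc p * 2) (onEdge e22 D) ≡ sumBelow (suc p * 2) (onEdge e33 D)
  balanced-BL L1 = begin
    sumBelow (suc p * 2) (onEdge e22 D)       ≡⟨ count22-pairs ⟩
    sumBelow (suc p) (pairSum (onEdge e22 D)) ≡⟨ telescope-closed (suc p) _ _ threeAtPair step potential-closed ⟩
    sumBelow (suc p) (pairSum (onEdge e33 D)) ≡⟨ sym count33-pairs ⟩
    sumBelow (suc p * 2) (onEdge e33 D)       ∎
    where
    -- the vertex opening pair k ends the previous L-edge (or is D 0 = D m)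
    opening-vertex : ∀ k → k < suc p → Two3 (D (k * 2))
    opening-vertex zero _ = subst Two3 (sym closed) (Is23⇒Two3ʳ (L-is-23 _ (L-odd L1 p (n<1+n p))))
    opening-vertex (suc k) k<q = Is23⇒Two3ʳ (L-is-23 _ (L-odd L1 k (<-trans (n<1+n k) k<q)))
    step : ∀ k → k < suc p →
           pairSum (onEdge e22 D) k + threeAtPair k ≡ pairSum (onEdge e33 D) k + threeAtPair (suc k)
    step k k<q = BL-pair (opening-vertex k k<q) (L-is-23 (suc (k * 2)) (L-odd L1 k k<q))

  balanced : sumBelow (suc p * 2) (onEdge e22 D) ≡ sumBelow (suc p * 2) (onEdge e33 D)
  balanced with alternates 0 (s≤s (s≤s z≤n))
  ... | inj₁ (L0 , _) = balanced-LB L0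
  ... | inj₂ (_ , L1) = balanced-BL L1

alternating-cycle-balanced :
  ∀ m q → m ≡ q * 2 → (D : ℕ → ℕ) (L : ℕ → Set) → D 0 ≡ D m →
  (∀ i → suc i < m → (L i × ¬ L (suc i)) ⊎ (¬ L i × L (suc i))) →
  (∀ i → L i → Is23 (D i) (D (suc i))) →
  sumBelow m (onEdge e22 D) ≡ sumBelow m (onEdge e33 D)
alternating-cycle-balanced .0 zero refl D L _ _ _ = refl
alternating-cycle-balanced .(suc p * 2) (suc p) refl D L closed alternates L-is-23 =
  AlternatingCycle.balanced p D L closed alternates L-is-23

-- Position i of a walk of length m, truncated at m.
clamp : ∀ m → ℕ → Fin (suc m)
clamp zero _ = fz
clamp (suc m) zero = fz
clamp (suc m) (suc i) = fs (clamp m i)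

clamp-toℕ : ∀ {m} (x : Fin (suc m)) → clamp m (toℕ x) ≡ x
clamp-toℕ {zero} fz = refl
clamp-toℕ {suc m} fz = refl
clamp-toℕ {suc m} (fs x) = cong fs (clamp-toℕ x)

module _ {n : ℕ} {G : Graph n} (F : SForest n) (C : ClosedTrail G) where

  vertexAt : ℕ → Fin n
  vertexAt i = w C (clamp (len C) i)

  vertexAt-toℕ : ∀ x → vertexAt (toℕ x) ≡ w C x
  vertexAt-toℕ x = cong (w C) (clamp-toℕ x)

  degAt : ℕ → ℕ
  degAt i = deg F (vertexAt i)

  InLAt : ℕ → Set
  InLAt i = InL F (vertexAt i) (vertexAt (suc i))

  src-at : ∀ j → src C j ≡ vertexAt (toℕ j)
  src-at j = trans (sym (vertexAt-toℕ (inject₁ j))) (cong vertexAt (toℕ-inject₁ j))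

  tgt-at : ∀ j → tgt C j ≡ vertexAt (suc (toℕ j))
  tgt-at j = sym (vertexAt-toℕ (fs j))

  count-edges : ∀ P → length (filterᵇ (λ j → P (deg F (src C j)) (deg F (tgt C j))) (allFin (len C)))
                      ≡ sumBelow (len C) (onEdge P degAt)
  count-edges P = begin
    length (filterᵇ (λ j → P (deg F (src C j)) (deg F (tgt C j))) (allFin (len C)))
      ≡⟨ length-filter-allFin (len C) _ ⟩
    count (len C) (λ j → P (deg F (src C j)) (deg F (tgt C j)))
      ≡⟨ count-cong (len C) (λ j → cong₂ P (cong (deg F) (src-at j)) (cong (deg F) (tgt-at j))) ⟩
    count (len C) (λ j → P (degAt (toℕ j)) (degAt (suc (toℕ j))))
      ≡⟨ count-toℕ (len C) (λ i → P (degAt i) (degAt (suc i))) ⟩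
    sumBelow (len C) (onEdge P degAt) ∎

  degAt-closed : degAt 0 ≡ degAt (len C)
  degAt-closed = cong (deg F) (begin
    vertexAt 0                         ≡⟨ vertexAt-toℕ fz ⟩
    w C fz                             ≡⟨ closed C ⟩
    w C (fromℕ (len C))                ≡⟨ sym (vertexAt-toℕ (fromℕ (len C))) ⟩
    vertexAt (toℕ (fromℕ (len C)))     ≡⟨ cong vertexAt (toℕ-fromℕ (len C)) ⟩
    vertexAt (len C)                   ∎)

  InL-at : ∀ j {i} → toℕ j ≡ i → InL F (src C j) (tgt C j) ≡ InLAt i
  InL-at j refl = cong₂ (InL F) (src-at j) (tgt-at j)

  -- Alternation of C, read on positions (a B(G,F)-edge is not an L(F)-edge).
  alternatesAt : Alternating G F C → ∀ i → suc i < len C →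
                 (InLAt i × ¬ InLAt (suc i)) ⊎ (¬ InLAt i × InLAt (suc i))
  alternatesAt alternating i 1+i<m =
    Sum.map (Product.map (to L-i) (λ B → proj₁ (proj₂ B) ∘ from L-j))
            (Product.map (λ B → proj₁ (proj₂ B) ∘ from L-i) (to L-j))
            (alternating i′ j′ (trans (toℕ-fromℕ< 1+i<m) (cong suc (sym (toℕ-fromℕ< i<m)))))
    where
    i<m : i < len C
    i<m = <-trans (n<1+n i) 1+i<m
    i′ j′ : Fin (len C)
    i′ = fromℕ< i<m
    j′ = fromℕ< 1+i<m
    L-i : InL F (src C i′) (tgt C i′) ≡ InLAt i
    L-i = InL-at i′ (toℕ-fromℕ< i<m)
    L-j : InL F (src C j′) (tgt C j′) ≡ InLAt (suc i)
    L-j = InL-at j′ (toℕ-fromℕ< 1+i<m)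
    to : ∀ {A B : Set} → A ≡ B → A → B
    to = subst id
    from : ∀ {A B : Set} → A ≡ B → B → A
    from = subst id ∘ sym

-- The theorem: 2-2 and 3-3 edges are equinumerous on every L(F)-B(G,F)
-- alternating even closed trail.
mainTheorem3 : {n : ℕ} (G : Graph n) (F : SForest n) → Spanning G F →
               (C : ClosedTrail G) → IsEven C → Alternating G F C →
               count22 F C ≡ count33 F C
mainTheorem3 G F _ C (divides q len≡q*2) alternating = begin
  count22 F C                                ≡⟨ count-edges F C e22 ⟩
  sumBelow (len C) (onEdge e22 (degAt F C))  ≡⟨ alternating-cycle-balanced (len C) q len≡q*2
                                                   (degAt F C) (InLAt F C) (degAt-closed F C)
                                                   (alternatesAt F C alternating)
                                                   (λ _ → L-edge-23 F _ _) ⟩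
  sumBelow (len C) (onEdge e33 (degAt F C))  ≡⟨ count-edges F C e33 ⟨
  count33 F C                                ∎
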